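{- For every gene tree forest $F$, $\mathcal{PB}(F)=\mathcal{PP}(F)$.
   Context: A gene tree is a rooted binary tree (internal vertex $x$ has children $x_l,x_r$) whose leaves are labeled by genome labels (labels may repeat); a gene tree forest $F$ is a finite set of gene trees. $L(x)$ is the set of leaf labels in the subtree rooted at $x$, $L(F)$ the set of all leaf labels. A bipartition $B=(V_1,V_2)$ of $L(F)$ is a pair of disjoint nonempty sets with union $L(F)$, viewed as a species tree with root $v$ having children $v_1,v_2$ with leaf sets $V_1,V_2$. The LCA mapping $M$ sends a vertex $x$ of $F$ to the unique vertex $w$ of this tree with $L(x)\subseteq L(w)$ such that $w$ is a leaf or $L(x)$ is not contained in the leaf set of any child of $w$; $d_1(F,B)$ is the number of internal vertices $x$ with $M(x)=v$ and ($M(x_l)=v$ or $M(x_r)=v$). A bipartition is optimal if it minimizes $d_1(F,B)$. Label internal vertices of $F$ injectively by $1,\dots,m$; $H(F)$ has vertex set $L(F)$ and an edge between distinct $s,t$ labeled $a$ whenever the internal vertex $x$ labeled $a$ satisfies $\{s,t\}\subseteq L(x_l)$ or $\{s,t\}\subseteq L(x_r)$. A prefix of $F$ is a set $I$ of vertices closed under taking ancestors; $P(I)$ is the partition of $L(F)$ into connected components of $H(F)$ after deleting all edges whose label is the label of a vertex of $I$. A prefix is optimal if it has minimum size among prefixes $I$ with $|P(I)|\geq 2$. $\mathcal{PB}(F)$ is the partition of $L(F)$ in which two elements are in the same part iff they lie in the same part of every optimal bipartition; $\mathcal{PP}(F)$ is the partition of $L(F)$ in which two elements are in the same part iff they lie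 in the same part of $P(I)$ for every optimal prefix $I$. -}

module Defs where

open import Data.Nat using (ℕ; zero; suc; _+_; _≤_)
open import Data.Bool using (Bool; true; false; _∧_; _∨_; not; if_then_else_)
open import Data.List using (List; []; _∷_; _++_; concatMap)
open import Data.Bool.ListAction using (any)
open import Data.List.Membership.Propositional using (_∈_)
open import Data.List.Relation.Unary.All using (All; []; _∷_)
open import Data.Product using (_×_; ∃; ∃-syntax; _,_)
open import Data.Sum using (_⊎_)
open import Data.Empty using (⊥)
open import Data.Unit using (⊤)
open import Function using (_∘_)
open import Relation.Nullary using (¬_)
open import Relation.Binary.PropositionalEquality using (_≡_; _≢_)
open import Relation.Binary.Construct.Closure.ReflexiveTransitive using (Star)

data Tree : Set where
  leaf : ℕ → Tree
  node : Tree → Tree → Tree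

Forest : Set
Forest = List Tree

-- L(x): leaf labels (as a list, possibly with repetitions)
labels : Tree → List ℕ
labels (leaf a)   = a ∷ []
labels (node l r) = labels l ++ labels r

labelsF : Forest → List ℕ
labelsF = concatMap labels

-- Bipartitions B = (V₁ , V₂) of L(F), given by a side function:
-- V₁ = { s ∈ L(F) | side s ≡ true },  V₂ = { s ∈ L(F) | side s ≡ false }.

IsBipartition : Forest → (ℕ → Bool) → Set
IsBipartition F side =
  (∃[ s ] (s ∈ labelsF F × side s ≡ true)) ×
  (∃[ s ] (s ∈ labelsF F × side s ≡ false))

-- M(x) = v (the root of the species tree) iff L(x) ⊈ V₁ and L(x) ⊈ V₂,
-- i.e. L(x) meets both V₁ and V₂.
mapsToRoot : (ℕ → Bool) → Tree → Bool
mapsToRoot side x = any side (labels x) ∧ any (not ∘ side) (labels x)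

d1T : (ℕ → Bool) → Tree → ℕ
d1T side (leaf _)   = 0
d1T side (node l r) =
  (if mapsToRoot side (node l r) ∧ (mapsToRoot side l ∨ mapsToRoot side r)
   then 1 else 0) + d1T side l + d1T side r

d1 : Forest → (ℕ → Bool) → ℕ
d1 []      side = 0
d1 (T ∷ F) side = d1T side T + d1 F side

OptimalBipartition : Forest → (ℕ → Bool) → Set
OptimalBipartition F side =
  IsBipartition F side ×
  (∀ side' → IsBipartition F side' → d1 F side ≤ d1 F side')

SamePB : Forest → ℕ → ℕ → Set
SamePB F s t = ∀ side → OptimalBipartition F side → side s ≡ side t

-- Sets of vertices of a gene tree: a Boolean mark on every vertex
-- (true = the vertex belongs to the set).

data Mark : Tree → Set where
  mleaf : ∀ {a} → Bool → Mark (leaf a)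
  mnode : ∀ {l r} → Bool → Mark l → Mark r → Mark (node l r)

None : ∀ {T} → Mark T → Set
None (mleaf b)       = b ≡ false
None (mnode b ml mr) = b ≡ false × None ml × None mr

-- closed under taking ancestors: an unmarked vertex has no marked descendant
Closed : ∀ {T} → Mark T → Set
Closed (mleaf b)           = ⊤
Closed (mnode true ml mr)  = Closed ml × Closed mr
Closed (mnode false ml mr) = None ml × None mr

sizeT : ∀ {T} → Mark T → ℕ
sizeT (mleaf b)       = if b then 1 else 0
sizeT (mnode b ml mr) = (if b then 1 else 0) + sizeT ml + sizeT mr

VertexSet : Forest → Set
VertexSet F = All Mark F

IsPrefix : (F : Forest) → VertexSet F → Set
IsPrefix []      []       = ⊤
IsPrefix (T ∷ F) (m ∷ ms) = Closed m × IsPrefix F ms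

size : (F : Forest) → VertexSet F → ℕ
size []      []       = 0
size (T ∷ F) (m ∷ ms) = sizeT m + size F ms

-- Edges of H(F) whose label is not the label of a vertex of I:
-- an internal vertex x ∉ I contributes an edge {s,t} (s ≢ t) whenever
-- {s,t} ⊆ L(x_l) or {s,t} ⊆ L(x_r).

data EdgeT : (T : Tree) → Mark T → ℕ → ℕ → Set where
  here-l : ∀ {l r ml mr s t} → s ∈ labels l → t ∈ labels l → s ≢ t →
           EdgeT (node l r) (mnode false ml mr) s t
  here-r : ∀ {l r ml mr s t} → s ∈ labels r → t ∈ labels r → s ≢ t →
           EdgeT (node l r) (mnode false ml mr) s t
  in-l   : ∀ {l r b ml mr s t} → EdgeT l ml s t → EdgeT (node l r) (mnode b ml mr) s t
  in-r   : ∀ {l r b ml mr s t} → EdgeT r mr s t → EdgeT (node l r) (mnode b ml mr) s t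

EdgeF : (F : Forest) → VertexSet F → ℕ → ℕ → Set
EdgeF []      []       s t = ⊥
EdgeF (T ∷ F) (m ∷ ms) s t = EdgeT T m s t ⊎ EdgeF F ms s t

-- s and t lie in the same part of P(I) (connected component of H(F) minus
-- the edges labelled by vertices of I); used for s, t ∈ L(F).
SameP : (F : Forest) → VertexSet F → ℕ → ℕ → Set
SameP F I = Star (EdgeF F I)

-- |P(I)| ≥ 2 : two elements of L(F) lie in different parts
AtLeastTwoParts : (F : Forest) → VertexSet F → Set
AtLeastTwoParts F I =
  ∃[ s ] ∃[ t ] (s ∈ labelsF F × t ∈ labelsF F × ¬ SameP F I s t)

OptimalPrefix : (F : Forest) → VertexSet F → Set
OptimalPrefix F I =
  IsPrefix F I × AtLeastTwoParts F I ×
  (∀ J → IsPrefix F J → AtLeastTwoParts F J → size F I ≤ size F J)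

SamePP : Forest → ℕ → ℕ → Set
SamePP F s t = ∀ I → OptimalPrefix F I → SameP F I s t

module Submission where

-- A bipartition B determines the prefix I_B of the vertices counted by d₁(F,B), so |I_B| = d₁(F,B).
-- A vertex x ∉ I_B has monochromatic children, hence every edge of H(F) that survives I_B joins two
-- labels on the same side of B, and P(I_B) refines B. Conversely, if every edge surviving a vertex
-- set I respects B, then no vertex outside I is counted, so d₁(F,B) ≤ |I|; taking for B the
-- component in P(I) of one label shows that every prefix with two parts bounds some d₁(F,B).
-- So min d₁ = min |I|: optimal bipartitions give optimal prefixes I_B whose parts refine them, and
-- the component bipartitions of an optimal prefix are optimal, which identifies PB(F) and PP(F).

open import Defs
open import Data.Nat using (ℕ; _+_; _≤_; z≤n; s≤s; _≟_)
open import Data.Nat.Properties using (≤-reflexive; +-mono-≤; module ≤-Reasoning)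
open import Data.Bool using (Bool; true; false; T; _∧_; _∨_; not; if_then_else_)
open import Data.Bool.Properties using (T-≡; T-not-≡; T-∧; ∧-zeroʳ; ∨-conicalˡ; ∨-conicalʳ)
open import Data.List using (List; []; _∷_)
open import Data.List.Membership.Propositional using (_∈_; lose; find)
open import Data.List.Membership.Propositional.Properties using (∈-++⁺ˡ; ∈-++⁺ʳ)
open import Data.List.Membership.DecPropositional _≟_ using (_∈?_)
open import Data.List.Relation.Binary.Subset.Propositional using (_⊆_)
open import Data.List.Relation.Unary.Any using (here; there)
open import Data.List.Relation.Unary.Any.Properties using (any⁺; any⁻)
open import Data.List.Relation.Unary.All using ([]; _∷_)
open import Data.Product using (_×_; ∃-syntax; _,_; proj₁; proj₂)
open import Data.Sum using (_⊎_; inj₁; inj₂; [_,_])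
open import Data.Empty using (⊥-elim)
open import Data.Unit using (tt)
open import Function using (_∘_)
open import Level using (0ℓ)
open import Function.Bundles using (_⇔_; mk⇔; Equivalence)
open import Relation.Nullary using (¬_; Dec; does; yes; no; contradiction)
open import Relation.Nullary.Decidable using (map′; _⊎-dec_; _×-dec_; ¬?; dec-true; dec-false)
open import Relation.Binary.Core using (Rel; _Preserves_⟶_)
open import Relation.Binary.Definitions using (Decidable; DecidableEquality)
open import Relation.Binary.PropositionalEquality using (_≡_; _≢_; refl; sym; trans; cong; cong₂; subst)
open import Relation.Binary.Construct.Closure.ReflexiveTransitive using (Star; ε; _◅_; _◅◅_; fold)

open Equivalence using (to; from)

Star-preserves : ∀ {A B : Set} {E : Rel A 0ℓ} (f : A → B) →
  f Preserves E ⟶ _≡_ → f Preserves Star E ⟶ _≡_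
Star-preserves f f-pres = fold (λ u w → f u ≡ f w) (λ e eq → trans (f-pres e) eq) refl

Monochromatic : (ℕ → Bool) → List ℕ → Set
Monochromatic side xs = ∀ {u w} → u ∈ xs → w ∈ xs → side u ≡ side w

monochromatic-if-distinct : ∀ (side : ℕ → Bool) xs →
  (∀ {u w} → u ∈ xs → w ∈ xs → u ≢ w → side u ≡ side w) → Monochromatic side xs
monochromatic-if-distinct side xs distinct {u} {w} u∈ w∈ with u ≟ w
... | yes refl = refl
... | no u≢w   = distinct u∈ w∈ u≢w

module _ (side : ℕ → Bool) where

  mapsToRoot-if-split : ∀ x {u w} → u ∈ labels x → w ∈ labels x →
    side u ≡ true → side w ≡ false → T (mapsToRoot side x)
  mapsToRoot-if-split x u∈x w∈x su sw = from T-∧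
    ( any⁺ side (lose u∈x (from T-≡ su))
    , any⁺ (not ∘ side) (lose w∈x (from T-not-≡ sw)) )

  mapsToRoot≡false⇒monochromatic : ∀ x → mapsToRoot side x ≡ false → Monochromatic side (labels x)
  mapsToRoot≡false⇒monochromatic x off {u} {w} u∈x w∈x with side u in su | side w in sw
  ... | true  | true  = refl
  ... | false | false = refl
  ... | true  | false = ⊥-elim (subst T off (mapsToRoot-if-split x u∈x w∈x su sw))
  ... | false | true  = ⊥-elim (subst T off (mapsToRoot-if-split x w∈x u∈x sw su))

  monochromatic⇒mapsToRoot≡false : ∀ x → Monochromatic side (labels x) → mapsToRoot side x ≡ false
  monochromatic⇒mapsToRoot≡false x mono with mapsToRoot side x in on
  ... | false = refl
  ... | true with to T-∧ (from T-≡ on)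
  ...   | some-true , some-false with find (any⁻ side _ some-true) | find (any⁻ (not ∘ side) _ some-false)
  ...     | u , u∈x , su | w , w∈x , sw =
    ⊥-elim (subst T (to T-not-≡ sw) (subst T (mono u∈x w∈x) su))

  mapsToRoot≡false-⊆ : ∀ x y → labels y ⊆ labels x → mapsToRoot side x ≡ false → mapsToRoot side y ≡ false
  mapsToRoot≡false-⊆ x y y⊆x off =
    monochromatic⇒mapsToRoot≡false y λ u∈ w∈ → mapsToRoot≡false⇒monochromatic x off (y⊆x u∈) (y⊆x w∈)

  mapsToRoot≡false-children : ∀ l r → mapsToRoot side (node l r) ≡ false →
    mapsToRoot side l ≡ false × mapsToRoot side r ≡ false
  mapsToRoot≡false-children l r off =
    mapsToRoot≡false-⊆ (node l r) l ∈-++⁺ˡ off , mapsToRoot≡false-⊆ (node l r) r (∈-++⁺ʳ (labels l)) off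

  counted : Tree → Tree → Bool
  counted l r = mapsToRoot side (node l r) ∧ (mapsToRoot side l ∨ mapsToRoot side r)

  uncounted⇒children-mapsToRoot≡false : ∀ l r → counted l r ≡ false →
    mapsToRoot side l ≡ false × mapsToRoot side r ≡ false
  uncounted⇒children-mapsToRoot≡false l r c with mapsToRoot side (node l r) in off
  ... | false = mapsToRoot≡false-children l r off
  ... | true  = ∨-conicalˡ _ _ c , ∨-conicalʳ _ _ c

  children-mapsToRoot≡false⇒uncounted : ∀ l r →
    mapsToRoot side l ≡ false → mapsToRoot side r ≡ false → counted l r ≡ false
  children-mapsToRoot≡false⇒uncounted l r offˡ offʳ rewrite offˡ | offʳ = ∧-zeroʳ _

  countedVertices : (x : Tree) → Mark x
  countedVertices (leaf _)   = mleaf false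
  countedVertices (node l r) = mnode (counted l r) (countedVertices l) (countedVertices r)

  countedVertices-none : ∀ x → mapsToRoot side x ≡ false → None (countedVertices x)
  countedVertices-none (leaf _)   _   = refl
  countedVertices-none (node l r) off =
    children-mapsToRoot≡false⇒uncounted l r offˡ offʳ
      , countedVertices-none l offˡ , countedVertices-none r offʳ
    where
    offˡ = proj₁ (mapsToRoot≡false-children l r off)
    offʳ = proj₂ (mapsToRoot≡false-children l r off)

  countedVertices-closed : ∀ x → Closed (countedVertices x)
  countedVertices-closed (leaf _) = tt
  countedVertices-closed (node l r) with counted l r in c
  ... | true  = countedVertices-closed l , countedVertices-closed r
  ... | false =
    let offˡ , offʳ = uncounted⇒children-mapsToRoot≡false l r c
    in  countedVertices-none l offˡ , countedVertices-none r offʳ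

  sizeT-countedVertices : ∀ x → sizeT (countedVertices x) ≡ d1T side x
  sizeT-countedVertices (leaf _)   = refl
  sizeT-countedVertices (node l r) =
    cong₂ (λ m n → (if counted l r then 1 else 0) + m + n)
      (sizeT-countedVertices l) (sizeT-countedVertices r)

  countedVertices-preserves : ∀ x → side Preserves EdgeT x (countedVertices x) ⟶ _≡_
  countedVertices-preserves (node l r) e with counted l r in c | e
  ... | false | here-l u∈ w∈ _ =
    mapsToRoot≡false⇒monochromatic l (proj₁ (uncounted⇒children-mapsToRoot≡false l r c)) u∈ w∈
  ... | false | here-r u∈ w∈ _ =
    mapsToRoot≡false⇒monochromatic r (proj₂ (uncounted⇒children-mapsToRoot≡false l r c)) u∈ w∈
  ... | _ | in-l e′ = countedVertices-preserves l e′
  ... | _ | in-r e′ = countedVertices-preserves r e′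

  d1T≤sizeT : ∀ x (I : Mark x) → side Preserves EdgeT x I ⟶ _≡_ → d1T side x ≤ sizeT I
  d1T≤sizeT (leaf _)   _               _    = z≤n
  d1T≤sizeT (node l r) (mnode b Iˡ Iʳ) pres =
    +-mono-≤ (+-mono-≤ (counted≤ b pres) (d1T≤sizeT l Iˡ (pres ∘ in-l))) (d1T≤sizeT r Iʳ (pres ∘ in-r))
    where
    off : ∀ y → (∀ {u w} → u ∈ labels y → w ∈ labels y → u ≢ w → side u ≡ side w) →
      mapsToRoot side y ≡ false
    off y distinct = monochromatic⇒mapsToRoot≡false y (monochromatic-if-distinct side (labels y) distinct)

    counted≤ : ∀ b → side Preserves EdgeT (node l r) (mnode b Iˡ Iʳ) ⟶ _≡_ →
      (if counted l r then 1 else 0) ≤ (if b then 1 else 0)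
    counted≤ false pres = ≤-reflexive (cong (λ c → if c then 1 else 0)
      (children-mapsToRoot≡false⇒uncounted l r
        (off l λ u∈ w∈ u≢w → pres (here-l u∈ w∈ u≢w))
        (off r λ u∈ w∈ u≢w → pres (here-r u∈ w∈ u≢w))))
    counted≤ true _ with counted l r
    ... | true  = s≤s z≤n
    ... | false = z≤n

  countedVerticesF : (F : Forest) → VertexSet F
  countedVerticesF []      = []
  countedVerticesF (x ∷ F) = countedVertices x ∷ countedVerticesF F

  countedVerticesF-prefix : ∀ F → IsPrefix F (countedVerticesF F)
  countedVerticesF-prefix []      = tt
  countedVerticesF-prefix (x ∷ F) = countedVertices-closed x , countedVerticesF-prefix F

  size-countedVerticesF : ∀ F → size F (countedVerticesF F) ≡ d1 F side
  size-countedVerticesF []      = refl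
  size-countedVerticesF (x ∷ F) =
    cong₂ _+_ (sizeT-countedVertices x) (size-countedVerticesF F)

  countedVerticesF-preserves : ∀ F → side Preserves EdgeF F (countedVerticesF F) ⟶ _≡_
  countedVerticesF-preserves (x ∷ F) (inj₁ e) = countedVertices-preserves x e
  countedVerticesF-preserves (x ∷ F) (inj₂ e) = countedVerticesF-preserves F e

  d1≤size : ∀ F (I : VertexSet F) → side Preserves EdgeF F I ⟶ _≡_ → d1 F side ≤ size F I
  d1≤size []      []      _    = z≤n
  d1≤size (x ∷ F) (m ∷ I) pres = +-mono-≤ (d1T≤sizeT x m (pres ∘ inj₁)) (d1≤size F I (pres ∘ inj₂))

  preserving⇒atLeastTwoParts : ∀ F (I : VertexSet F) → IsBipartition F side →
    side Preserves EdgeF F I ⟶ _≡_ → AtLeastTwoParts F I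
  preserving⇒atLeastTwoParts F I ((s , s∈ , s-true) , (t , t∈ , t-false)) pres =
    s , t , s∈ , t∈ , λ s~t →
      contradiction (trans (sym s-true) (trans (Star-preserves side pres s~t) t-false)) λ ()

-- Paths are found by the Floyd–Warshall recursion on the allowed intermediate vertices; every
-- vertex a path visits after its start is the target of an edge, hence lies in V.
module Reachability {A : Set} (_≟ᴬ_ : DecidableEquality A) (E : Rel A 0ℓ) (E? : Decidable E)
                    (V : List A) (target∈V : ∀ {u w} → E u w → w ∈ V) where

  Via : List A → A → A → Set
  Via []      u x = u ≡ x ⊎ E u x
  Via (w ∷ W) u x = Via W u x ⊎ (Via W u w × Via W w x)

  via? : ∀ W → Decidable (Via W)
  via? []      u x = (u ≟ᴬ x) ⊎-dec E? u x
  via? (w ∷ W) u x = via? W u x ⊎-dec (via? W u w ×-dec via? W w x)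

  via⇒star : ∀ W {u x} → Via W u x → Star E u x
  via⇒star []      (inj₁ refl)    = ε
  via⇒star []      (inj₂ e)       = e ◅ ε
  via⇒star (w ∷ W) (inj₁ p)       = via⇒star W p
  via⇒star (w ∷ W) (inj₂ (p , q)) = via⇒star W p ◅◅ via⇒star W q

  via-weaken : ∀ W {u x} → Via [] u x → Via W u x
  via-weaken []      p = p
  via-weaken (w ∷ W) p = inj₁ (via-weaken W p)

  via-into : ∀ W {w u} → Via (w ∷ W) u w → Via W u w
  via-into W (inj₁ p)       = p
  via-into W (inj₂ (p , _)) = p

  via-out-of : ∀ W {w x} → Via (w ∷ W) w x → Via W w x
  via-out-of W (inj₁ p)       = p
  via-out-of W (inj₂ (_ , q)) = q

  via-trans : ∀ W {u y x} → y ∈ W → Via W u y → Via W y x → Via W u x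
  via-trans (w ∷ W) (here refl) p q = inj₂ (via-into W p , via-out-of W q)
  via-trans (w ∷ W) (there y∈W) (inj₁ p)       (inj₁ q)       = inj₁ (via-trans W y∈W p q)
  via-trans (w ∷ W) (there y∈W) (inj₁ p)       (inj₂ (q , q′)) = inj₂ (via-trans W y∈W p q , q′)
  via-trans (w ∷ W) (there y∈W) (inj₂ (p , p′)) (inj₁ q)       = inj₂ (p , via-trans W y∈W p′ q)
  via-trans (w ∷ W) (there y∈W) (inj₂ (p , _))  (inj₂ (_ , q′)) = inj₂ (p , q′)

  star⇒via : ∀ {u x} → Star E u x → Via V u x
  star⇒via ε       = via-weaken V (inj₁ refl)
  star⇒via (e ◅ p) = via-trans V (target∈V e) (via-weaken V (inj₂ e)) (star⇒via p)

  star? : Decidable (Star E)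
  star? u x = map′ (via⇒star V) star⇒via (via? V u x)

edgeT? : ∀ x (I : Mark x) → Decidable (EdgeT x I)
edgeT? (leaf _)   _                  _ _ = no λ ()
edgeT? (node l r) (mnode true Iˡ Iʳ) u w =
  map′ [ in-l , in-r ] (λ { (in-l e) → inj₁ e ; (in-r e) → inj₂ e })
    (edgeT? l Iˡ u w ⊎-dec edgeT? r Iʳ u w)
edgeT? (node l r) (mnode false Iˡ Iʳ) u w =
  map′ [ (λ (a , b , c) → here-l a b c) , [ (λ (a , b , c) → here-r a b c) , [ in-l , in-r ] ] ]
    (λ { (here-l a b c) → inj₁ (a , b , c) ; (here-r a b c) → inj₂ (inj₁ (a , b , c))
       ; (in-l e) → inj₂ (inj₂ (inj₁ e)) ; (in-r e) → inj₂ (inj₂ (inj₂ e)) })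
    (pairIn? l ⊎-dec pairIn? r ⊎-dec edgeT? l Iˡ u w ⊎-dec edgeT? r Iʳ u w)
  where
  pairIn? : ∀ y → Dec (u ∈ labels y × w ∈ labels y × u ≢ w)
  pairIn? y = u ∈? labels y ×-dec w ∈? labels y ×-dec ¬? (u ≟ w)

edgeF? : ∀ F (I : VertexSet F) → Decidable (EdgeF F I)
edgeF? []      []      _ _ = no λ ()
edgeF? (x ∷ F) (m ∷ I) u w = edgeT? x m u w ⊎-dec edgeF? F I u w

edgeT-sym : ∀ x (I : Mark x) {u w} → EdgeT x I u w → EdgeT x I w u
edgeT-sym (node l r) _               (here-l a b c) = here-l b a (c ∘ sym)
edgeT-sym (node l r) _               (here-r a b c) = here-r b a (c ∘ sym)
edgeT-sym (node l r) (mnode _ Iˡ Iʳ) (in-l e)       = in-l (edgeT-sym l Iˡ e)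
edgeT-sym (node l r) (mnode _ Iˡ Iʳ) (in-r e)       = in-r (edgeT-sym r Iʳ e)

edgeF-sym : ∀ F (I : VertexSet F) {u w} → EdgeF F I u w → EdgeF F I w u
edgeF-sym (x ∷ F) (m ∷ I) (inj₁ e) = inj₁ (edgeT-sym x m e)
edgeF-sym (x ∷ F) (m ∷ I) (inj₂ e) = inj₂ (edgeF-sym F I e)

edgeT-target∈labels : ∀ x (I : Mark x) {u w} → EdgeT x I u w → w ∈ labels x
edgeT-target∈labels (node l r) _               (here-l _ b _) = ∈-++⁺ˡ b
edgeT-target∈labels (node l r) _               (here-r _ b _) = ∈-++⁺ʳ (labels l) b
edgeT-target∈labels (node l r) (mnode _ Iˡ Iʳ) (in-l e)       = ∈-++⁺ˡ (edgeT-target∈labels l Iˡ e)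
edgeT-target∈labels (node l r) (mnode _ Iˡ Iʳ) (in-r e)       = ∈-++⁺ʳ (labels l) (edgeT-target∈labels r Iʳ e)

edgeF-target∈labelsF : ∀ F (I : VertexSet F) {u w} → EdgeF F I u w → w ∈ labelsF F
edgeF-target∈labelsF (x ∷ F) (m ∷ I) (inj₁ e) = ∈-++⁺ˡ (edgeT-target∈labels x m e)
edgeF-target∈labelsF (x ∷ F) (m ∷ I) (inj₂ e) = ∈-++⁺ʳ (labels x) (edgeF-target∈labelsF F I e)

sameP? : ∀ F (I : VertexSet F) → Decidable (SameP F I)
sameP? F I = Reachability.star? _≟_ (EdgeF F I) (edgeF? F I) (labelsF F) (edgeF-target∈labelsF F I)

componentOf : ∀ F (I : VertexSet F) → ℕ → ℕ → Bool
componentOf F I u w = does (sameP? F I u w)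

componentOf-separates : ∀ F (I : VertexSet F) {u w} → ¬ SameP F I u w →
  componentOf F I u u ≡ true × componentOf F I u w ≡ false
componentOf-separates F I {u} {w} u≁w = dec-true (sameP? F I u u) ε , dec-false (sameP? F I u w) u≁w

componentOf-preserves : ∀ F (I : VertexSet F) u → componentOf F I u Preserves EdgeF F I ⟶ _≡_
componentOf-preserves F I u {v} {w} e with sameP? F I u v
... | yes u~v = trans (dec-true (sameP? F I u v) u~v) (sym (dec-true (sameP? F I u w) (u~v ◅◅ e ◅ ε)))
... | no  u≁v = trans (dec-false (sameP? F I u v) u≁v)
  (sym (dec-false (sameP? F I u w) λ u~w → u≁v (u~w ◅◅ edgeF-sym F I e ◅ ε)))

componentOf-bipartition : ∀ F (I : VertexSet F) {u w} → u ∈ labelsF F → w ∈ labelsF F →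
  ¬ SameP F I u w → IsBipartition F (componentOf F I u)
componentOf-bipartition F I u∈ w∈ u≁w =
  let u-true , w-false = componentOf-separates F I u≁w in (_ , u∈ , u-true) , (_ , w∈ , w-false)

atLeastTwoParts⇒d1≤size : ∀ F (J : VertexSet F) → AtLeastTwoParts F J →
  ∃[ side ] (IsBipartition F side × d1 F side ≤ size F J)
atLeastTwoParts⇒d1≤size F J (u , w , u∈ , w∈ , u≁w) =
  componentOf F J u , componentOf-bipartition F J u∈ w∈ u≁w ,
  d1≤size (componentOf F J u) F J (componentOf-preserves F J u)

countedVerticesF-optimal : ∀ F side → OptimalBipartition F side → OptimalPrefix F (countedVerticesF side F)
countedVerticesF-optimal F side (bipartition , minimal) =
  countedVerticesF-prefix side F ,
  preserving⇒atLeastTwoParts side F _ bipartition (countedVerticesF-preserves side F) ,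
  λ J _ twoParts → let side′ , bipartition′ , d1′≤size = atLeastTwoParts⇒d1≤size F J twoParts in
    begin
      size F (countedVerticesF side F) ≡⟨ size-countedVerticesF side F ⟩
      d1 F side                        ≤⟨ minimal side′ bipartition′ ⟩
      d1 F side′                       ≤⟨ d1′≤size ⟩
      size F J                         ∎
  where open ≤-Reasoning

componentOf-optimal : ∀ F (I : VertexSet F) {u w} → OptimalPrefix F I →
  u ∈ labelsF F → w ∈ labelsF F → ¬ SameP F I u w → OptimalBipartition F (componentOf F I u)
componentOf-optimal F I {u} (_ , _ , minimal) u∈ w∈ u≁w =
  componentOf-bipartition F I u∈ w∈ u≁w ,
  λ side′ bipartition′ → begin
    d1 F (componentOf F I u)          ≤⟨ d1≤size (componentOf F I u) F I (componentOf-preserves F I u) ⟩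
    size F I                          ≤⟨ minimal _ (countedVerticesF-prefix side′ F)
                                           (preserving⇒atLeastTwoParts side′ F _ bipartition′
                                             (countedVerticesF-preserves side′ F)) ⟩
    size F (countedVerticesF side′ F) ≡⟨ size-countedVerticesF side′ F ⟩
    d1 F side′                        ∎
  where open ≤-Reasoning

proposition1 : (F : Forest) → (s t : ℕ) → s ∈ labelsF F → t ∈ labelsF F →
    SamePB F s t ⇔ SamePP F s t
proposition1 F s t s∈ t∈ = mk⇔ samePB⇒samePP samePP⇒samePB
  where
  samePB⇒samePP : SamePB F s t → SamePP F s t
  samePB⇒samePP samePB I optimal with sameP? F I s t
  ... | yes s~t = s~t
  ... | no  s≁t =
    let s-true , t-false = componentOf-separates F I s≁t
        same-side        = samePB _ (componentOf-optimal F I optimal s∈ t∈ s≁t)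
    in  contradiction (trans (sym s-true) (trans same-side t-false)) λ ()

  samePP⇒samePB : SamePP F s t → SamePB F s t
  samePP⇒samePB samePP side optimal =
    Star-preserves side (countedVerticesF-preserves side F)
      (samePP _ (countedVerticesF-optimal F side optimal))
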